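{- Let $M$ be a multi-path matroid of nullity $m$, and let $\sigma$ be a cyclic permutation of its ground set. Every set in any minimal $\sigma$-interval presentation of $M$ has at most $m+1$ elements.
   Context: Transversal matroid $M[\mathcal{A}]$ of a multiset $\mathcal{A}=(A_1,\ldots,A_r)$ of subsets of a finite set $S$: independent sets are the partial transversals. A presentation $(A_1,\ldots,A_r)$ contains a presentation $(A'_1,\ldots,A'_r)$ if $A'_i\subseteq A_i$ for all $i$. For a cyclic permutation $\sigma$ of $S$, a $\sigma$-interval is a nonempty set $\{f,\sigma(f),\ldots,l\}$; a $\sigma$-interval presentation of $M$ is a presentation by an antichain (no member containing another) of $\sigma$-intervals, and it is minimal if it contains no other $\sigma$-interval presentation of $M$. A multi-path matroid is a transversal matroid having a $\sigma$-interval presentation for some cyclic permutation $\sigma$ of its ground set. The nullity of $M$ is $|S|$ minus its rank. -}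

module Defs where

open import Data.Nat using (ℕ; zero; suc; _+_; _≤_)
open import Data.Fin using (Fin)
open import Data.Fin.Subset using (Subset; _∈_; _⊆_; ∣_∣)
open import Data.Product using (Σ; ∃; ∃-syntax; _×_)
open import Function using (_⇔_)
open import Relation.Nullary using (¬_)
open import Relation.Binary.PropositionalEquality using (_≡_)

iter : ∀ {n} → (Fin n → Fin n) → ℕ → Fin n → Fin n
iter σ zero x = x
iter σ (suc k) x = σ (iter σ k x)

IsCyclic : ∀ {n} → (Fin n → Fin n) → Set
IsCyclic {n} σ =
  (∀ x y → σ x ≡ σ y → x ≡ y) × (∀ x y → ∃[ k ] iter σ k x ≡ y)

IsInterval : ∀ {n} → (Fin n → Fin n) → Subset n → Set
IsInterval {n} σ I =
  ∃[ f ] ∃[ k ] (∀ x → (x ∈ I) ⇔ (∃[ j ] (j ≤ k × iter σ j f ≡ x)))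

IsPartialTransversal : ∀ {n r} → (Fin r → Subset n) → Subset n → Set
IsPartialTransversal {n} {r} 𝒜 T =
  Σ (Fin n → Fin r) λ φ →
    (∀ x → x ∈ T → x ∈ 𝒜 (φ x)) ×
    (∀ x y → x ∈ T → y ∈ T → φ x ≡ φ y → x ≡ y)

-- A matroid on Fin n is given by its independence predicate.
-- 𝒜 is a presentation of M if M = M[𝒜] (same independent sets).
Presents : ∀ {n r} → (Fin r → Subset n) → (Subset n → Set) → Set
Presents {n} 𝒜 M = ∀ (T : Subset n) → IsPartialTransversal 𝒜 T ⇔ M T

-- Antichain (as a multiset: no member contains another member).
IsAntichain : ∀ {n r} → (Fin r → Subset n) → Set
IsAntichain 𝒜 = ∀ i j → ¬ (i ≡ j) → ¬ (𝒜 i ⊆ 𝒜 j)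

IsIntervalPresentation : ∀ {n r} → (Fin n → Fin n) → (Subset n → Set) →
                         (Fin r → Subset n) → Set
IsIntervalPresentation σ M 𝒜 =
  Presents 𝒜 M × IsAntichain 𝒜 × (∀ i → IsInterval σ (𝒜 i))

IsMinimalIntervalPresentation : ∀ {n r} → (Fin n → Fin n) →
  (Subset n → Set) → (Fin r → Subset n) → Set
IsMinimalIntervalPresentation {n} {r} σ M 𝒜 =
  IsIntervalPresentation σ M 𝒜 ×
  (∀ (𝒜′ : Fin r → Subset n) → IsIntervalPresentation σ M 𝒜′ →
     (∀ i → 𝒜′ i ⊆ 𝒜 i) → ∀ i → 𝒜′ i ≡ 𝒜 i)

IsMultiPath : ∀ {n} → (Subset n → Set) → Set
IsMultiPath {n} M =
  ∃[ σ ] (IsCyclic σ × ∃[ r ] ∃[ 𝒜 ] IsIntervalPresentation {n} {r} σ M 𝒜)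

HasNullity : ∀ {n} → (Subset n → Set) → ℕ → Set
HasNullity {n} M m =
  (∃[ I ] (M I × ∣ I ∣ + m ≡ n)) × (∀ I → M I → ∣ I ∣ + m ≤ n)

-- Let b be a member of maximum size and suppose |𝒜 b| ≥ m + 2. Dropping the last point of
-- the interval B = 𝒜 b leaves an interval B′ with |B′| > m. If B′ lay in no other member,
-- replacing B by B′ would keep the antichain and, by Hall's theorem, the matroid: a subset D
-- of an independent set meeting B only in its last point has members avoiding it only with
-- distinct starts outside B′ ∪ D, so fewer than r - |D| of them, and keeps a surplus of
-- neighbours. Minimality thus puts B′ into another member, which is again of maximum size and
-- starts just before B does. Walking backwards around the cycle, every point starts a
-- member, so the singletons of the starts form a σ-interval presentation inside 𝒜, and
-- minimality makes every member a singleton, contradicting |𝒜 b| ≥ 2.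
module Submission where

open import Defs
open import Data.Bool using (true; false)
open import Data.Empty using (⊥; ⊥-elim)
open import Data.Fin using (Fin; zero; suc) renaming (_≟_ to _≟ᶠ_)
open import Data.Fin.Properties using (any?)
open import Data.Fin.Subset hiding (⊥)
open import Data.Fin.Subset.Properties
open import Data.Nat using (ℕ; zero; suc; pred; _+_; _∸_; _≤_; _<_; z≤n; s≤s; ≢-nonZero)
open import Data.Nat.Properties
open import Data.List using (allFin)
open import Data.List.Extrema ≤-totalOrder using (argmax; f[xs]≤f[argmax])
open import Data.List.Membership.Propositional.Properties using (∈-allFin)
import Data.List.Relation.Unary.All as All
open import Data.Product using (Σ; ∃-syntax; _×_; _,_; proj₁; proj₂)
open import Data.Sum using (_⊎_; inj₁; inj₂)
open import Data.Vec using ([]; _∷_; there; tabulate)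
open import Data.Vec.Properties using (lookup∘tabulate; []=⇒lookup; lookup⇒[]=)
open import Data.Vec.Functional using (updateAt)
open import Data.Vec.Functional.Properties using (updateAt-updates; updateAt-minimal)
open import Function using (_∘_; _⇔_; mk⇔; Equivalence)
open import Relation.Nullary using (¬_; yes; no; does; ¬?; _×-dec_)
open import Relation.Nullary.Decidable using (dec-true; decidable-stable)
open import Level using (0ℓ)
open import Relation.Unary as U using (Pred)
open import Relation.Binary.Core using (REL)
import Relation.Binary.Definitions as B
open import Relation.Binary.PropositionalEquality

private variable
  n r : ℕ

∣p∣≡∣p∩q∣+∣p─q∣ : (p q : Subset n) → ∣ p ∣ ≡ ∣ p ∩ q ∣ + ∣ p ─ q ∣
∣p∣≡∣p∩q∣+∣p─q∣ []          []          = refl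
∣p∣≡∣p∩q∣+∣p─q∣ (true  ∷ p) (true  ∷ q) = cong suc (∣p∣≡∣p∩q∣+∣p─q∣ p q)
∣p∣≡∣p∩q∣+∣p─q∣ (true  ∷ p) (false ∷ q) = trans (cong suc (∣p∣≡∣p∩q∣+∣p─q∣ p q)) (sym (+-suc _ _))
∣p∣≡∣p∩q∣+∣p─q∣ (false ∷ p) (true  ∷ q) = ∣p∣≡∣p∩q∣+∣p─q∣ p q
∣p∣≡∣p∩q∣+∣p─q∣ (false ∷ p) (false ∷ q) = ∣p∣≡∣p∩q∣+∣p─q∣ p q

∣p∪q∣+∣p∩q∣≡∣p∣+∣q∣ : (p q : Subset n) → ∣ p ∪ q ∣ + ∣ p ∩ q ∣ ≡ ∣ p ∣ + ∣ q ∣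
∣p∪q∣+∣p∩q∣≡∣p∣+∣q∣ []          []          = refl
∣p∪q∣+∣p∩q∣≡∣p∣+∣q∣ (true  ∷ p) (true  ∷ q) =
  cong suc (trans (+-suc _ _) (trans (cong suc (∣p∪q∣+∣p∩q∣≡∣p∣+∣q∣ p q)) (sym (+-suc _ _))))
∣p∪q∣+∣p∩q∣≡∣p∣+∣q∣ (true  ∷ p) (false ∷ q) = cong suc (∣p∪q∣+∣p∩q∣≡∣p∣+∣q∣ p q)
∣p∪q∣+∣p∩q∣≡∣p∣+∣q∣ (false ∷ p) (true  ∷ q) = trans (cong suc (∣p∪q∣+∣p∩q∣≡∣p∣+∣q∣ p q)) (sym (+-suc _ _))
∣p∪q∣+∣p∩q∣≡∣p∣+∣q∣ (false ∷ p) (false ∷ q) = ∣p∪q∣+∣p∩q∣≡∣p∣+∣q∣ p q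

∣p∪q∣≤∣p∣+∣q∣ : (p q : Subset n) → ∣ p ∪ q ∣ ≤ ∣ p ∣ + ∣ q ∣
∣p∪q∣≤∣p∣+∣q∣ p q = subst (∣ p ∪ q ∣ ≤_) (∣p∪q∣+∣p∩q∣≡∣p∣+∣q∣ p q) (m≤m+n _ _)

Empty⇒∣p∣≡0 : {p : Subset n} → Empty p → ∣ p ∣ ≡ 0
Empty⇒∣p∣≡0 {n} e = trans (cong ∣_∣ (Empty-unique e)) (∣⊥∣≡0 n)

Disjoint : Subset n → Subset n → Set
Disjoint p q = ∀ {x} → x ∈ p → x ∉ q

1≤∣p∣⇒Nonempty : {p : Subset n} → 1 ≤ ∣ p ∣ → Nonempty p
1≤∣p∣⇒Nonempty {p = p} 1≤∣p∣ with nonempty? p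
... | yes p≠∅ = p≠∅
... | no  p=∅ = ⊥-elim (1+n≰n (subst (1 ≤_) (Empty⇒∣p∣≡0 p=∅) 1≤∣p∣))

disjoint⇒∣p∣+∣q∣≤∣p∪q∣ : (p q : Subset n) → Disjoint p q → ∣ p ∣ + ∣ q ∣ ≤ ∣ p ∪ q ∣
disjoint⇒∣p∣+∣q∣≤∣p∪q∣ p q p∩q=∅ = begin
  ∣ p ∣ + ∣ q ∣             ≡⟨ ∣p∪q∣+∣p∩q∣≡∣p∣+∣q∣ p q ⟨
  ∣ p ∪ q ∣ + ∣ p ∩ q ∣     ≡⟨ cong (∣ p ∪ q ∣ +_) (Empty⇒∣p∣≡0 empty) ⟩
  ∣ p ∪ q ∣ + 0             ≡⟨ +-identityʳ _ ⟩
  ∣ p ∪ q ∣                 ∎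
  where
  open ≤-Reasoning
  empty : Empty (p ∩ q)
  empty (x , x∈p∩q) = let (x∈p , x∈q) = x∈p∩q⁻ p q x∈p∩q in p∩q=∅ x∈p x∈q

∣p∣+∣∁p∣≡n : (p : Subset n) → ∣ p ∣ + ∣ ∁ p ∣ ≡ n
∣p∣+∣∁p∣≡n {n} p = trans (cong (∣ p ∣ +_) (∣∁p∣≡n∸∣p∣ p)) (m+[n∸m]≡n (∣p∣≤n p))

q⊆p⇒∣q∣+∣p─q∣≡∣p∣ : {p q : Subset n} → q ⊆ p → ∣ q ∣ + ∣ p ─ q ∣ ≡ ∣ p ∣
q⊆p⇒∣q∣+∣p─q∣≡∣p∣ {p = p} {q} q⊆p = begin
  ∣ q ∣ + ∣ p ─ q ∣      ≡⟨ cong (_+ ∣ p ─ q ∣) ∣q∣≡∣p∩q∣ ⟩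
  ∣ p ∩ q ∣ + ∣ p ─ q ∣  ≡⟨ ∣p∣≡∣p∩q∣+∣p─q∣ p q ⟨
  ∣ p ∣                  ∎
  where
  open ≡-Reasoning
  ∣q∣≡∣p∩q∣ : ∣ q ∣ ≡ ∣ p ∩ q ∣
  ∣q∣≡∣p∩q∣ = ≤-antisym (p⊆q⇒∣p∣≤∣q∣ (λ x∈q → x∈p∩q⁺ (q⊆p x∈q , x∈q))) (∣p∩q∣≤∣q∣ p q)

x∈p⇒⁅x⁆⊆p : {p : Subset n} {x : Fin n} → x ∈ p → ⁅ x ⁆ ⊆ p
x∈p⇒⁅x⁆⊆p {x = x} x∈p y∈⁅x⁆ = subst (_∈ _) (sym (x∈⁅y⁆⇒x≡y x y∈⁅x⁆)) x∈p

x∈p⇒1≤∣p∣ : {p : Subset n} {x : Fin n} → x ∈ p → 1 ≤ ∣ p ∣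
x∈p⇒1≤∣p∣ {x = x} x∈p = subst (_≤ _) (∣⁅x⁆∣≡1 x) (p⊆q⇒∣p∣≤∣q∣ (x∈p⇒⁅x⁆⊆p x∈p))

∣p∣≤1+∣p-x∣ : (p : Subset n) (x : Fin n) → ∣ p ∣ ≤ suc ∣ p - x ∣
∣p∣≤1+∣p-x∣ p x = begin
  ∣ p ∣                             ≡⟨ ∣p∣≡∣p∩q∣+∣p─q∣ p ⁅ x ⁆ ⟩
  ∣ p ∩ ⁅ x ⁆ ∣ + ∣ p - x ∣         ≤⟨ +-monoˡ-≤ _ (∣p∩q∣≤∣q∣ p ⁅ x ⁆) ⟩
  ∣ ⁅ x ⁆ ∣ + ∣ p - x ∣             ≡⟨ cong (_+ ∣ p - x ∣) (∣⁅x⁆∣≡1 x) ⟩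
  suc ∣ p - x ∣                     ∎
  where open ≤-Reasoning

x∈p⇒∣p∣≡1+∣p-x∣ : (p : Subset n) {x : Fin n} → x ∈ p → ∣ p ∣ ≡ suc ∣ p - x ∣
x∈p⇒∣p∣≡1+∣p-x∣ p {x} x∈p = ≤-antisym (∣p∣≤1+∣p-x∣ p x) (x∈p⇒∣p-x∣<∣p∣ x∈p)

2+∣p∣≤∣q∣ : {p q : Subset n} {u v : Fin n} → p ⊆ q →
  u ∈ q → u ∉ p → v ∈ q → v ∉ p → u ≢ v → 2 + ∣ p ∣ ≤ ∣ q ∣
2+∣p∣≤∣q∣ {p = p} {q} {u} {v} p⊆q u∈q u∉p v∈q v∉p u≢v =
  subst (2 + ∣ p ∣ ≤_) (sym (x∈p⇒∣p∣≡1+∣p-x∣ q u∈q)) (s≤s (p⊂q⇒∣p∣<∣q∣ (p⊆q-u , v , v∈q-u , v∉p)))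
  where
  p⊆q-u : p ⊆ q - u
  p⊆q-u x∈p = x∈p∧x≢y⇒x∈p-y (p⊆q x∈p) (λ { refl → u∉p x∈p })
  v∈q-u : v ∈ q - u
  v∈q-u = x∈p∧x≢y⇒x∈p-y v∈q (u≢v ∘ sym)

x∈p─q⇒x∉q : (p q : Subset n) {x : Fin n} → x ∈ p ─ q → x ∉ q
x∈p─q⇒x∉q (_ ∷ p) (true  ∷ q) {zero}  ()
x∈p─q⇒x∉q (_ ∷ p) (false ∷ q) {zero}  _          ()
x∈p─q⇒x∉q (_ ∷ p) (_     ∷ q) {suc x} (there x∈) (there x∈q) = x∈p─q⇒x∉q p q x∈ x∈q

x∈p-y⇒x≢y : (p : Subset n) {x y : Fin n} → x ∈ p - y → x ≢ y
x∈p-y⇒x≢y p {y = y} x∈p-y refl = x∈p─q⇒x∉q p ⁅ y ⁆ x∈p-y (x∈⁅x⁆ y)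

x∈p-y⇒x∈p : (p : Subset n) {x y : Fin n} → x ∈ p - y → x ∈ p
x∈p-y⇒x∈p p {y = y} = p─q⊆p p ⁅ y ⁆

p⊈q⇒∃∈p∉q : (p q : Subset n) → ¬ p ⊆ q → ∃[ y ] (y ∈ p × y ∉ q)
p⊈q⇒∃∈p∉q p q p⊈q with any? (λ y → (y ∈? p) ×-dec ¬? (y ∈? q))
... | yes w = w
... | no ∄ = ⊥-elim (p⊈q (λ {y} y∈p → decidable-stable (y ∈? q) (λ y∉q → ∄ (y , y∈p , y∉q))))

InjectiveOn : Subset n → (Fin n → Fin r) → Set
InjectiveOn p f = ∀ x y → x ∈ p → y ∈ p → f x ≡ f y → x ≡ y

injectiveOn⇒∣p∣≤∣q∣ : (p : Subset n) (q : Subset r) (f : Fin n → Fin r) →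
  (∀ x → x ∈ p → f x ∈ q) → InjectiveOn p f → ∣ p ∣ ≤ ∣ q ∣
injectiveOn⇒∣p∣≤∣q∣ p q f = go _ p q refl
  where
  go : ∀ k (p : Subset _) (q : Subset _) → ∣ p ∣ ≡ k →
       (∀ x → x ∈ p → f x ∈ q) → InjectiveOn p f → ∣ p ∣ ≤ ∣ q ∣
  go zero    p q ∣p∣≡0 _ _ = subst (_≤ ∣ q ∣) (sym ∣p∣≡0) z≤n
  go (suc k) p q ∣p∣≡k maps inj with nonempty? p
  ... | no  p=∅ = ⊥-elim (0≢1+n (trans (sym (Empty⇒∣p∣≡0 p=∅)) ∣p∣≡k))
  ... | yes (x , x∈p) = subst₂ _≤_ (sym (x∈p⇒∣p∣≡1+∣p-x∣ p x∈p)) (sym (x∈p⇒∣p∣≡1+∣p-x∣ q (maps x x∈p)))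
                          (s≤s (go k (p - x) (q - f x) ∣p-x∣≡k maps′ inj′))
    where
    ∣p-x∣≡k : ∣ p - x ∣ ≡ k
    ∣p-x∣≡k = suc-injective (trans (sym (x∈p⇒∣p∣≡1+∣p-x∣ p x∈p)) ∣p∣≡k)
    maps′ : ∀ y → y ∈ p - x → f y ∈ q - f x
    maps′ y y∈ = x∈p∧x≢y⇒x∈p-y (maps y (x∈p-y⇒x∈p p y∈))
                   (λ fy≡fx → x∈p-y⇒x≢y p y∈ (inj y x (x∈p-y⇒x∈p p y∈) x∈p fy≡fx))
    inj′ : InjectiveOn (p - x) f
    inj′ y z y∈ z∈ = inj y z (x∈p-y⇒x∈p p y∈) (x∈p-y⇒x∈p p z∈)

p⊆q∪[p─q] : (p q : Subset n) → p ⊆ q ∪ (p ─ q)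
p⊆q∪[p─q] p q {x} x∈p with x ∈? q
... | yes x∈q = x∈p∪q⁺ (inj₁ x∈q)
... | no  x∉q = x∈p∪q⁺ (inj₂ (x∈p∧x∉q⇒x∈p─q x∈p x∉q))

subsetOf : {P : Pred (Fin n) 0ℓ} → U.Decidable P → Subset n
subsetOf P? = tabulate (does ∘ P?)

∈subsetOf⁺ : {P : Pred (Fin n) 0ℓ} (P? : U.Decidable P) {x : Fin n} → P x → x ∈ subsetOf P?
∈subsetOf⁺ P? {x} px = lookup⇒[]= x _ (trans (lookup∘tabulate _ x) (dec-true (P? x) px))

∈subsetOf⁻ : {P : Pred (Fin n) 0ℓ} (P? : U.Decidable P) {x : Fin n} → x ∈ subsetOf P? → P x
∈subsetOf⁻ P? {x} x∈ with P? x | trans (sym (lookup∘tabulate (does ∘ P?) x)) ([]=⇒lookup x∈)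
... | yes px | _  = px
... | no  _  | ()

module Hall {n r : ℕ} where

  Matching : REL (Fin n) (Fin r) 0ℓ → Subset n → Set
  Matching R T = Σ (Fin n → Fin r) λ ψ → (∀ x → x ∈ T → R x (ψ x)) × InjectiveOn T ψ

  module _ {R : REL (Fin n) (Fin r) 0ℓ} (R? : B.Decidable R) where

    Neighbour : Subset n → Pred (Fin r) 0ℓ
    Neighbour D j = ∃[ x ] (x ∈ D × R x j)

    neighbour? : ∀ D → U.Decidable (Neighbour D)
    neighbour? D j = any? (λ x → (x ∈? D) ×-dec R? x j)

    neighbours : Subset n → Subset r
    neighbours D = subsetOf (neighbour? D)

    neighbours⁺ : ∀ {D x j} → x ∈ D → R x j → j ∈ neighbours D
    neighbours⁺ {D} x∈D Rxj = ∈subsetOf⁺ (neighbour? D) (_ , x∈D , Rxj)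

    neighbours⁻ : ∀ {D j} → j ∈ neighbours D → Neighbour D j
    neighbours⁻ {D} = ∈subsetOf⁻ (neighbour? D)

    HallCondition : Subset n → Set
    HallCondition T = ∀ D → D ⊆ T → ∣ D ∣ ≤ ∣ neighbours D ∣

  Avoiding : REL (Fin n) (Fin r) 0ℓ → Subset r → REL (Fin n) (Fin r) 0ℓ
  Avoiding R S x j = R x j × j ∉ S

  avoiding? : ∀ {R} → B.Decidable R → (S : Subset r) → B.Decidable (Avoiding R S)
  avoiding? R? S x j = R? x j ×-dec ¬? (j ∈? S)

  matching-⊆ : ∀ {R T T′} → T′ ⊆ T → Matching R T → Matching R T′
  matching-⊆ T′⊆T (ψ , ψ-R , ψ-inj) =
    ψ , (λ x x∈ → ψ-R x (T′⊆T x∈)) , (λ x y x∈ y∈ → ψ-inj x y (T′⊆T x∈) (T′⊆T y∈))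

  matching-∪ : ∀ {R S D E} (μ : Matching R D) → (∀ x → x ∈ D → proj₁ μ x ∈ S) →
               Matching (Avoiding R S) E → Matching R (D ∪ E)
  matching-∪ {R} {S} {D} {E} (ψ₁ , ψ₁-R , ψ₁-inj) ψ₁∈S (ψ₂ , ψ₂-R , ψ₂-inj) = ψ , ψ-R , ψ-inj
    where
    ∈E : ∀ {x} → x ∈ D ∪ E → x ∉ D → x ∈ E
    ∈E {x} x∈ x∉D with x∈p∪q⁻ D E x∈
    ... | inj₁ x∈D = ⊥-elim (x∉D x∈D)
    ... | inj₂ x∈E = x∈E
    ψ : Fin n → Fin r
    ψ x with x ∈? D
    ... | yes _ = ψ₁ x
    ... | no  _ = ψ₂ x
    ψ-R : ∀ x → x ∈ D ∪ E → R x (ψ x)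
    ψ-R x x∈ with x ∈? D
    ... | yes x∈D = ψ₁-R x x∈D
    ... | no  x∉D = proj₁ (ψ₂-R x (∈E x∈ x∉D))
    ψ-inj : InjectiveOn (D ∪ E) ψ
    ψ-inj x y x∈ y∈ eq with x ∈? D | y ∈? D
    ... | yes x∈D | yes y∈D = ψ₁-inj x y x∈D y∈D eq
    ... | no  x∉D | no  y∉D = ψ₂-inj x y (∈E x∈ x∉D) (∈E y∈ y∉D) eq
    ... | yes x∈D | no  y∉D = ⊥-elim (proj₂ (ψ₂-R y (∈E y∈ y∉D)) (subst (_∈ S) eq (ψ₁∈S x x∈D)))
    ... | no  x∉D | yes y∈D = ⊥-elim (proj₂ (ψ₂-R x (∈E x∈ x∉D)) (subst (_∈ S) (sym eq) (ψ₁∈S y y∈D)))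

  hallCondition-outsideTight : ∀ {R} (R? : B.Decidable R) {T D} → HallCondition R? T → D ⊆ T →
    ∣ neighbours R? D ∣ ≤ ∣ D ∣ → HallCondition (avoiding? R? (neighbours R? D)) (T ─ D)
  hallCondition-outsideTight {R} R? {T} {D} hall D⊆T tight E E⊆T─D =
    +-cancelʳ-≤ (∣ D ∣) (∣ E ∣) (∣ N′ E ∣) (begin
      ∣ E ∣ + ∣ D ∣              ≤⟨ disjoint⇒∣p∣+∣q∣≤∣p∪q∣ E D (λ x∈E → x∈p─q⇒x∉q T D (E⊆T─D x∈E)) ⟩
      ∣ E ∪ D ∣                  ≤⟨ hall (E ∪ D) E∪D⊆T ⟩
      ∣ N (E ∪ D) ∣              ≤⟨ p⊆q⇒∣p∣≤∣q∣ N[E∪D]⊆N′E∪ND ⟩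
      ∣ N′ E ∪ N D ∣             ≤⟨ ∣p∪q∣≤∣p∣+∣q∣ (N′ E) (N D) ⟩
      ∣ N′ E ∣ + ∣ N D ∣         ≤⟨ +-monoʳ-≤ (∣ N′ E ∣) tight ⟩
      ∣ N′ E ∣ + ∣ D ∣           ∎)
    where
    open ≤-Reasoning
    N N′ : Subset n → Subset r
    N = neighbours R?
    N′ = neighbours (avoiding? R? (N D))
    E∪D⊆T : E ∪ D ⊆ T
    E∪D⊆T x∈ with x∈p∪q⁻ E D x∈
    ... | inj₁ x∈E = p─q⊆p T D (E⊆T─D x∈E)
    ... | inj₂ x∈D = D⊆T x∈D
    N[E∪D]⊆N′E∪ND : N (E ∪ D) ⊆ N′ E ∪ N D
    N[E∪D]⊆N′E∪ND {j} j∈ with j ∈? N D | neighbours⁻ R? j∈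
    ... | yes j∈ND | _ = x∈p∪q⁺ (inj₂ j∈ND)
    ... | no  j∉ND | x , x∈E∪D , Rxj with x∈p∪q⁻ E D x∈E∪D
    ...   | inj₁ x∈E = x∈p∪q⁺ (inj₁ (neighbours⁺ (avoiding? R? (N D)) x∈E (Rxj , j∉ND)))
    ...   | inj₂ x∈D = ⊥-elim (j∉ND (neighbours⁺ R? x∈D Rxj))

  hallCondition-avoidingOne : ∀ {R} (R? : B.Decidable R) {T} j →
    (∀ D → D ⊆ T → Nonempty D → ∣ D ∣ < ∣ neighbours R? D ∣) →
    HallCondition (avoiding? R? ⁅ j ⁆) T
  hallCondition-avoidingOne R? j surplus D D⊆T with nonempty? D
  ... | no  D=∅ = subst (_≤ ∣ neighbours (avoiding? R? ⁅ j ⁆) D ∣) (sym (Empty⇒∣p∣≡0 D=∅)) z≤n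
  ... | yes D≠∅ = ≤-pred (begin-strict
      ∣ D ∣                        <⟨ surplus D D⊆T D≠∅ ⟩
      ∣ neighbours R? D ∣          ≤⟨ ∣p∣≤1+∣p-x∣ (neighbours R? D) j ⟩
      suc ∣ neighbours R? D - j ∣  ≤⟨ s≤s (p⊆q⇒∣p∣≤∣q∣ N-j⊆N′) ⟩
      suc ∣ N′ ∣                   ∎)
    where
    open ≤-Reasoning
    N′ : Subset r
    N′ = neighbours (avoiding? R? ⁅ j ⁆) D
    N-j⊆N′ : neighbours R? D - j ⊆ N′
    N-j⊆N′ j′∈ with neighbours⁻ R? (x∈p-y⇒x∈p _ j′∈)
    ... | x , x∈D , Rxj′ = neighbours⁺ (avoiding? R? ⁅ j ⁆) x∈D (Rxj′ , x≢y⇒x∉⁅y⁆ (x∈p-y⇒x≢y _ j′∈))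

  hallCondition⇒neighbour : ∀ {R} (R? : B.Decidable R) {T x} → HallCondition R? T → x ∈ T → ∃[ j ] R x j
  hallCondition⇒neighbour R? {x = x} hall x∈T
    with j , j∈N ← 1≤∣p∣⇒Nonempty (subst (_≤ ∣ neighbours R? ⁅ x ⁆ ∣) (∣⁅x⁆∣≡1 x) (hall ⁅ x ⁆ (x∈p⇒⁅x⁆⊆p x∈T)))
    with y , y∈⁅x⁆ , Ryj ← neighbours⁻ R? j∈N
    rewrite x∈⁅y⁆⇒x≡y x y∈⁅x⁆ = j , Ryj

  matching-⁅⁆ : ∀ {R x j} → R x j → Matching R ⁅ x ⁆
  matching-⁅⁆ {R} {x} {j} Rxj = (λ _ → j) , ψ-R , ψ-inj
    where
    ψ-R : ∀ y → y ∈ ⁅ x ⁆ → R y j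
    ψ-R y y∈ rewrite x∈⁅y⁆⇒x≡y x y∈ = Rxj
    ψ-inj : InjectiveOn ⁅ x ⁆ (λ _ → j)
    ψ-inj y z y∈ z∈ _ = trans (x∈⁅y⁆⇒x≡y x y∈) (sym (x∈⁅y⁆⇒x≡y x z∈))

  -- Either some nonempty D ⊆ T - x is tight (|N D| = |D|), and D and T ─ D are matched
  -- separately, the latter avoiding N D; or every such D has a surplus, and x is matched to
  -- any neighbour j₁ while T - x avoids j₁. The index j₀ is only the (arbitrary) value of
  -- the matching on an empty T.
  hall-bounded : Fin r → ∀ k {R} (R? : B.Decidable R) T → ∣ T ∣ ≤ k → HallCondition R? T → Matching R T
  hall-bounded j₀ k R? T _ _ with nonempty? T
  ... | no T=∅ = (λ _ → j₀) , (λ x x∈T → ⊥-elim (T=∅ (x , x∈T))) , (λ x _ x∈T → ⊥-elim (T=∅ (x , x∈T)))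
  hall-bounded j₀ zero R? T ∣T∣≤0 _ | yes (x , x∈T) = ⊥-elim (1+n≰n (≤-trans (x∈p⇒1≤∣p∣ x∈T) ∣T∣≤0))
  hall-bounded j₀ (suc k) {R} R? T ∣T∣≤1+k hall | yes (x , x∈T)
    with anySubset? (λ D → (D ⊆? (T - x)) ×-dec (nonempty? D ×-dec (∣ neighbours R? D ∣ ≤? ∣ D ∣)))
  ... | yes (D , D⊆T-x , (y , y∈D) , tight) =
    matching-⊆ {R} (p⊆q∪[p─q] T D) (matching-∪ {R} matchD matchD∈N matchRest)
    where
    D⊆T : D ⊆ T
    D⊆T = x∈p-y⇒x∈p T ∘ D⊆T-x
    ∣T─D∣≤k : ∣ T ─ D ∣ ≤ k
    ∣T─D∣≤k = ≤-pred (≤-trans (p∩q≢∅⇒∣p─q∣<∣p∣ T D (y , x∈p∩q⁺ (D⊆T y∈D , y∈D))) ∣T∣≤1+k)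
    matchD : Matching R D
    matchD = hall-bounded j₀ k R? D (≤-trans (p⊆q⇒∣p∣≤∣q∣ D⊆T-x) ∣T-x∣≤k) (λ E E⊆D → hall E (D⊆T ∘ E⊆D))
      where
      ∣T-x∣≤k : ∣ T - x ∣ ≤ k
      ∣T-x∣≤k = ≤-pred (subst (_≤ suc k) (x∈p⇒∣p∣≡1+∣p-x∣ T x∈T) ∣T∣≤1+k)
    matchD∈N : ∀ z → z ∈ D → proj₁ matchD z ∈ neighbours R? D
    matchD∈N z z∈D = neighbours⁺ R? z∈D (proj₁ (proj₂ matchD) z z∈D)
    matchRest : Matching (Avoiding R (neighbours R? D)) (T ─ D)
    matchRest = hall-bounded j₀ k (avoiding? R? (neighbours R? D)) (T ─ D) ∣T─D∣≤k
                  (hallCondition-outsideTight R? hall D⊆T tight)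
  ... | no noTight =
    matching-⊆ {R} (p⊆q∪[p─q] T ⁅ x ⁆) (matching-∪ {R} (matching-⁅⁆ {R} Rxj₁) (λ _ _ → x∈⁅x⁆ j₁) matchRest)
    where
    j₁ : Fin r
    j₁ = proj₁ (hallCondition⇒neighbour R? hall x∈T)
    Rxj₁ : R x j₁
    Rxj₁ = proj₂ (hallCondition⇒neighbour R? hall x∈T)
    matchRest : Matching (Avoiding R ⁅ j₁ ⁆) (T - x)
    matchRest = hall-bounded j₀ k (avoiding? R? ⁅ j₁ ⁆) (T - x)
                  (≤-pred (subst (_≤ suc k) (x∈p⇒∣p∣≡1+∣p-x∣ T x∈T) ∣T∣≤1+k))
                  (hallCondition-avoidingOne R? j₁ λ D D⊆ D≠∅ → ≰⇒> (λ le → noTight (D , D⊆ , D≠∅ , le)))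

  hall : ∀ {R} (R? : B.Decidable R) {T} → Fin r → HallCondition R? T → Matching R T
  hall R? {T} j₀ = hall-bounded j₀ ∣ T ∣ R? T ≤-refl

module Arcs {n : ℕ} (σ : Fin n → Fin n) where

  Arc : Fin n → ℕ → Pred (Fin n) 0ℓ
  Arc f k x = ∃[ j ] (j ≤ k × iter σ j f ≡ x)

  iter-+ : ∀ a b x → iter σ (a + b) x ≡ iter σ a (iter σ b x)
  iter-+ zero    b x = refl
  iter-+ (suc a) b x = cong σ (iter-+ a b x)

  arc-mono : ∀ {f k k′ x} → k ≤ k′ → Arc f k x → Arc f k′ x
  arc-mono k≤k′ (j , j≤k , eq) = j , ≤-trans j≤k k≤k′ , eq

  arc-shrink : ∀ {f k x} → Arc f (suc k) x → x ≢ iter σ (suc k) f → Arc f k x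
  arc-shrink (j , j≤1+k , refl) x≢last with m≤n⇒m<n∨m≡n j≤1+k
  ... | inj₁ j<1+k = j , ≤-pred j<1+k , refl
  ... | inj₂ refl  = ⊥-elim (x≢last refl)

  arc-overhang : ∀ {f k a c} → a ≤ k → ¬ Arc f k (iter σ c (iter σ a f)) → Arc (iter σ a f) c (iter σ k f)
  arc-overhang {f} {k} {a} {c} a≤k leaves with c + a ≤? k
  ... | yes c+a≤k = ⊥-elim (leaves (c + a , c+a≤k , iter-+ c a f))
  ... | no  c+a≰k = k ∸ a , m≤n+o⇒m∸n≤o k a k≤a+c , (begin
      iter σ (k ∸ a) (iter σ a f)  ≡⟨ iter-+ (k ∸ a) a f ⟨
      iter σ (k ∸ a + a) f         ≡⟨ cong (λ t → iter σ t f) (m∸n+n≡m a≤k) ⟩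
      iter σ k f                   ∎)
    where
    open ≡-Reasoning
    k≤a+c : k ≤ a + c
    k≤a+c = subst (k ≤_) (+-comm c a) (<⇒≤ (≰⇒> c+a≰k))

  module _ (reach : ∀ x y → ∃[ k ] iter σ k x ≡ y) where

    arc-closed⇒full : ∀ {f k} → Arc f k (iter σ (suc k) f) → ∀ y → Arc f k y
    arc-closed⇒full {f} {k} closed y with c , σᶜf≡y ← reach f y = subst (Arc f k) σᶜf≡y (along c)
      where
      step : ∀ {x} → Arc f k x → Arc f k (σ x)
      step (j , j≤k , refl) with m≤n⇒m<n∨m≡n j≤k
      ... | inj₁ j<k = suc j , j<k , refl
      ... | inj₂ refl = closed
      along : ∀ c → Arc f k (iter σ c f)
      along zero    = 0 , z≤n , refl
      along (suc c) = step (along c)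

module _ {n r : ℕ} where
  open Hall

  Member : (Fin r → Subset n) → REL (Fin n) (Fin r) 0ℓ
  Member 𝒜 x j = x ∈ 𝒜 j

  member? : (𝒜 : Fin r → Subset n) → B.Decidable (Member 𝒜)
  member? 𝒜 x j = x ∈? 𝒜 j

  partialTransversal-mono : ∀ {𝒜 𝒜′ : Fin r → Subset n} {T} → (∀ j → 𝒜′ j ⊆ 𝒜 j) →
    IsPartialTransversal 𝒜′ T → IsPartialTransversal 𝒜 T
  partialTransversal-mono 𝒜′⊆𝒜 (φ , φ-∈ , φ-inj) = φ , (λ x x∈T → 𝒜′⊆𝒜 (φ x) (φ-∈ x x∈T)) , φ-inj

  partialTransversal⇒hallCondition : ∀ (𝒜 : Fin r → Subset n) {T} →
    IsPartialTransversal 𝒜 T → HallCondition (member? 𝒜) T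
  partialTransversal⇒hallCondition 𝒜 (φ , φ-∈ , φ-inj) D D⊆T =
    injectiveOn⇒∣p∣≤∣q∣ D (neighbours (member? 𝒜) D) φ
      (λ x x∈D → neighbours⁺ (member? 𝒜) x∈D (φ-∈ x (D⊆T x∈D)))
      (λ x y x∈D y∈D → φ-inj x y (D⊆T x∈D) (D⊆T y∈D))

  ∣partialTransversal∣≤r : ∀ {𝒜 : Fin r → Subset n} {T} → IsPartialTransversal 𝒜 T → ∣ T ∣ ≤ r
  ∣partialTransversal∣≤r {T = T} (φ , _ , φ-inj) =
    subst (∣ T ∣ ≤_) (∣⊤∣≡n r) (injectiveOn⇒∣p∣≤∣q∣ T ⊤ φ (λ _ _ → ∈⊤) φ-inj)

module IntervalAntichain
  {n r : ℕ} {σ : Fin n → Fin n} {𝒜 : Fin r → Subset n}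
  (antichain : IsAntichain 𝒜) (intervals : ∀ j → IsInterval σ (𝒜 j))
  where
  open Arcs σ

  start : Fin r → Fin n
  start j = proj₁ (intervals j)

  length : Fin r → ℕ
  length j = proj₁ (proj₂ (intervals j))

  last : Fin r → Fin n
  last j = iter σ (length j) (start j)

  ∈⇒arc : ∀ j {x} → x ∈ 𝒜 j → Arc (start j) (length j) x
  ∈⇒arc j {x} = Equivalence.to (proj₂ (proj₂ (intervals j)) x)

  arc⇒∈ : ∀ j {x} → Arc (start j) (length j) x → x ∈ 𝒜 j
  arc⇒∈ j {x} = Equivalence.from (proj₂ (proj₂ (intervals j)) x)

  start∈ : ∀ j → start j ∈ 𝒜 j
  start∈ j = arc⇒∈ j (0 , z≤n , refl)

  last∈ : ∀ j → last j ∈ 𝒜 j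
  last∈ j = arc⇒∈ j (length j , ≤-refl , refl)

  sameStart⇒⊆ : ∀ {i j} → start i ≡ start j → length i ≤ length j → 𝒜 i ⊆ 𝒜 j
  sameStart⇒⊆ {i} {j} same shorter x∈ =
    arc⇒∈ j (subst (λ s → Arc s (length j) _) same (arc-mono shorter (∈⇒arc i x∈)))

  start-injective : ∀ i j → start i ≡ start j → i ≡ j
  start-injective i j same with i ≟ᶠ j
  ... | yes i≡j = i≡j
  ... | no  i≢j with ≤-total (length i) (length j)
  ...   | inj₁ i≤j = ⊥-elim (antichain i j i≢j (sameStart⇒⊆ same i≤j))
  ...   | inj₂ j≤i = ⊥-elim (antichain j i (i≢j ∘ sym) (sameStart⇒⊆ (sym same) j≤i))

  last∈-overhanging : ∀ b j → start j ∈ 𝒜 b → ¬ 𝒜 j ⊆ 𝒜 b → last b ∈ 𝒜 j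
  last∈-overhanging b j start∈b 𝒜j⊈𝒜b
    with y , y∈j , y∉b ← p⊈q⇒∃∈p∉q (𝒜 j) (𝒜 b) 𝒜j⊈𝒜b
    with a , a≤ , σᵃ≡start ← ∈⇒arc b start∈b
    with c , c≤ , σᶜ≡y ← ∈⇒arc j y∈j
    = arc⇒∈ j (arc-mono c≤ (subst (λ s → Arc s c (last b)) σᵃ≡start (arc-overhang a≤ leaves)))
    where
    leaves : ¬ Arc (start b) (length b) (iter σ c (iter σ a (start b)))
    leaves on-b = y∉b (arc⇒∈ b (subst (Arc (start b) (length b)) (trans (cong (iter σ c) σᵃ≡start) σᶜ≡y) on-b))

maximizer : ∀ {r} (g : Fin r → ℕ) → Fin r → ∃[ b ] (∀ j → g j ≤ g b)
maximizer {r} g i = argmax g i (allFin r) , λ j → All.lookup (f[xs]≤f[argmax] i (allFin r)) (∈-allFin j)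

module MinimalIntervalPresentation
  {n r : ℕ} {M : Subset n → Set} {σ : Fin n → Fin n} {𝒜 : Fin r → Subset n}
  (cyclic : IsCyclic σ) (minimal : IsMinimalIntervalPresentation σ M 𝒜)
  {m : ℕ} {I : Subset n} (I-independent : M I) (∣I∣+m≡n : ∣ I ∣ + m ≡ n)
  where

  σ-injective : ∀ x y → σ x ≡ σ y → x ≡ y
  σ-injective = proj₁ cyclic

  reach : ∀ x y → ∃[ k ] iter σ k x ≡ y
  reach = proj₂ cyclic

  presents : Presents 𝒜 M
  presents = proj₁ (proj₁ minimal)

  antichain : IsAntichain 𝒜
  antichain = proj₁ (proj₂ (proj₁ minimal))

  intervals : ∀ j → IsInterval σ (𝒜 j)
  intervals = proj₂ (proj₂ (proj₁ minimal))

  open Arcs σ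
  open IntervalAntichain antichain intervals

  I-partialTransversal : IsPartialTransversal 𝒜 I
  I-partialTransversal = Equivalence.from (presents I) I-independent

  module BigMember (b : Fin r) (big : 2 + m ≤ ∣ 𝒜 b ∣) where

    B : Subset n
    B = 𝒜 b

    f : Fin n
    f = start b

    k : ℕ
    k = length b

    B≢everything : ¬ (∀ y → y ∈ B)
    B≢everything everything = <⇒≱ big (begin
      ∣ B ∣      ≤⟨ ∣p∣≤n B ⟩
      n          ≡⟨ ∣I∣+m≡n ⟨
      ∣ I ∣ + m  ≤⟨ +-monoˡ-≤ m ∣I∣≤1 ⟩
      1 + m      ∎)
      where
      open ≤-Reasoning
      only-b : ∀ j → j ≡ b
      only-b j with j ≟ᶠ b
      ... | yes j≡b = j≡b
      ... | no  j≢b = ⊥-elim (antichain j b j≢b (λ {x} _ → everything x))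
      ∣I∣≤1 : ∣ I ∣ ≤ 1
      ∣I∣≤1 = let (φ , _ , φ-inj) = I-partialTransversal in
        subst (∣ I ∣ ≤_) (∣⁅x⁆∣≡1 b)
          (injectiveOn⇒∣p∣≤∣q∣ I ⁅ b ⁆ φ (λ x _ → subst (_∈ ⁅ b ⁆) (sym (only-b (φ x))) (x∈⁅x⁆ b)) φ-inj)

    arc-not-closed : ∀ {c} → c ≤ k → ¬ Arc f c (iter σ (suc c) f)
    arc-not-closed c≤k closed = B≢everything (λ y → arc⇒∈ b (arc-mono c≤k (arc-closed⇒full reach closed y)))

    k≢0 : k ≢ 0
    k≢0 k≡0 = <⇒≱ big (begin
      ∣ B ∣        ≤⟨ p⊆q⇒∣p∣≤∣q∣ B⊆⁅f⁆ ⟩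
      ∣ ⁅ f ⁆ ∣    ≡⟨ ∣⁅x⁆∣≡1 f ⟩
      1            ≤⟨ s≤s z≤n ⟩
      1 + m        ∎)
      where
      open ≤-Reasoning
      B⊆⁅f⁆ : B ⊆ ⁅ f ⁆
      B⊆⁅f⁆ x∈B with j , j≤k , refl ← ∈⇒arc b x∈B
        rewrite n≤0⇒n≡0 (subst (j ≤_) k≡0 j≤k) = x∈⁅x⁆ f

    k′ : ℕ
    k′ = pred k

    1+k′≡k : suc k′ ≡ k
    1+k′≡k = suc-pred k {{≢-nonZero k≢0}}

    B′ : Subset n
    B′ = B - last b

    ∈B′⇔arc : ∀ x → x ∈ B′ ⇔ Arc f k′ x
    ∈B′⇔arc x = mk⇔ to from
      where
      to : x ∈ B′ → Arc f k′ x
      to x∈B′ = arc-shrink (arc-mono (≤-reflexive (sym 1+k′≡k)) (∈⇒arc b (x∈p-y⇒x∈p B x∈B′)))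
                           (λ x≡ → x∈p-y⇒x≢y B x∈B′ (trans x≡ (cong (λ t → iter σ t f) 1+k′≡k)))
      from : Arc f k′ x → x ∈ B′
      from on-arc = x∈p∧x≢y⇒x∈p-y (arc⇒∈ b (arc-mono k′≤k on-arc)) x≢last
        where
        k′≤k : k′ ≤ k
        k′≤k = ≤-trans (n≤1+n k′) (≤-reflexive 1+k′≡k)
        x≢last : x ≢ last b
        x≢last x≡last = arc-not-closed k′≤k
          (subst (Arc f k′) (trans x≡last (cong (λ t → iter σ t f) (sym 1+k′≡k))) on-arc)

    B′-interval : IsInterval σ B′
    B′-interval = f , k′ , ∈B′⇔arc

    B′⊆B : B′ ⊆ B
    B′⊆B = x∈p-y⇒x∈p B

    last∉B′ : last b ∉ B′
    last∉B′ last∈B′ = x∈p-y⇒x≢y B last∈B′ refl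

    f∈B′ : f ∈ B′
    f∈B′ = Equivalence.from (∈B′⇔arc f) (0 , z≤n , refl)

    ∣B∣≡1+∣B′∣ : ∣ B ∣ ≡ suc ∣ B′ ∣
    ∣B∣≡1+∣B′∣ = x∈p⇒∣p∣≡1+∣p-x∣ B (last∈ b)

    module Shrink (B′⊈others : ∀ j → j ≢ b → ¬ B′ ⊆ 𝒜 j) where

      𝒜′ : Fin r → Subset n
      𝒜′ = updateAt 𝒜 b (λ _ → B′)

      𝒜′-cases : ∀ j → (j ≡ b × 𝒜′ j ≡ B′) ⊎ (j ≢ b × 𝒜′ j ≡ 𝒜 j)
      𝒜′-cases j with j ≟ᶠ b
      ... | yes refl = inj₁ (refl , updateAt-updates b 𝒜)
      ... | no  j≢b  = inj₂ (j≢b , updateAt-minimal j b 𝒜 j≢b)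

      𝒜′⊆𝒜 : ∀ j → 𝒜′ j ⊆ 𝒜 j
      𝒜′⊆𝒜 j with 𝒜′-cases j
      ... | inj₁ (refl , 𝒜′b≡B′) = B′⊆B ∘ subst (_ ∈_) 𝒜′b≡B′
      ... | inj₂ (_    , 𝒜′j≡𝒜j) = subst (_ ∈_) 𝒜′j≡𝒜j

      𝒜′-intervals : ∀ j → IsInterval σ (𝒜′ j)
      𝒜′-intervals j with 𝒜′-cases j
      ... | inj₁ (refl , 𝒜′b≡B′) = subst (IsInterval σ) (sym 𝒜′b≡B′) B′-interval
      ... | inj₂ (_    , 𝒜′j≡𝒜j) = subst (IsInterval σ) (sym 𝒜′j≡𝒜j) (intervals j)

      𝒜′-antichain : IsAntichain 𝒜′
      𝒜′-antichain i j i≢j with 𝒜′-cases i | 𝒜′-cases j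
      ... | inj₁ (refl , _)     | inj₁ (refl , _)      = ⊥-elim (i≢j refl)
      ... | inj₁ (refl , i-eq)  | inj₂ (j≢b , j-eq)    = subst₂ (λ p q → ¬ p ⊆ q) (sym i-eq) (sym j-eq) (B′⊈others j j≢b)
      ... | inj₂ (i≢b , i-eq)   | inj₁ (refl , j-eq)   =
        subst₂ (λ p q → ¬ p ⊆ q) (sym i-eq) (sym j-eq) (λ 𝒜i⊆B′ → antichain i b i≢b (B′⊆B ∘ 𝒜i⊆B′))
      ... | inj₂ (_ , i-eq)     | inj₂ (_ , j-eq)      = subst₂ (λ p q → ¬ p ⊆ q) (sym i-eq) (sym j-eq) (antichain i j i≢j)

      N N′ : Subset n → Subset r
      N  = Hall.neighbours (member? 𝒜)
      N′ = Hall.neighbours (member? 𝒜′)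

      N-b⊆N′ : ∀ D → N D - b ⊆ N′ D
      N-b⊆N′ D j∈N-b with x , x∈D , x∈𝒜j ← Hall.neighbours⁻ (member? 𝒜) (x∈p-y⇒x∈p (N D) j∈N-b)
        = Hall.neighbours⁺ (member? 𝒜′) x∈D
            (subst (_ ∈_) (sym (updateAt-minimal _ b 𝒜 (x∈p-y⇒x≢y (N D) j∈N-b))) x∈𝒜j)

      N⊆N′ : ∀ D → (∀ {x} → x ∈ D → x ∈ B → ∃[ d ] (d ∈ D × d ∈ B′)) → N D ⊆ N′ D
      N⊆N′ D D∩B-reachesB′ {j} j∈ND with x , x∈D , x∈𝒜j ← Hall.neighbours⁻ (member? 𝒜) j∈ND | 𝒜′-cases j
      ... | inj₁ (refl , 𝒜′b≡B′) = let (d , d∈D , d∈B′) = D∩B-reachesB′ x∈D x∈𝒜j in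
        Hall.neighbours⁺ (member? 𝒜′) d∈D (subst (d ∈_) (sym 𝒜′b≡B′) d∈B′)
      ... | inj₂ (_ , 𝒜′j≡𝒜j) = Hall.neighbours⁺ (member? 𝒜′) x∈D (subst (x ∈_) (sym 𝒜′j≡𝒜j) x∈𝒜j)

      -- The members not meeting D have distinct starts outside B′ ∪ D (an interval starting
      -- in B′ and leaving B runs through last b ∈ D), so there are at most
      -- n - |B′| - |D| < |I| - |D| ≤ r - |D| of them.
      surplus : ∀ D → (∀ {x} → x ∈ D → x ∉ B′) → last b ∈ D → suc ∣ D ∣ ≤ ∣ N D ∣
      surplus D D∩B′=∅ last∈D =
        +-cancelʳ-≤ (∣ ∁ (N D) ∣) (suc ∣ D ∣) (∣ N D ∣) (+-cancelʳ-≤ m _ _ (begin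
          suc (∣ D ∣ + ∣ ∁ (N D) ∣) + m        ≡⟨ +-suc _ m ⟨
          ∣ D ∣ + ∣ ∁ (N D) ∣ + suc m          ≤⟨ +-mono-≤ (+-monoʳ-≤ ∣ D ∣ ∣∁ND∣≤) 1+m≤∣B′∣ ⟩
          ∣ D ∣ + ∣ ∁ B′ ─ D ∣ + ∣ B′ ∣         ≡⟨ cong (_+ ∣ B′ ∣) (q⊆p⇒∣q∣+∣p─q∣≡∣p∣ D⊆∁B′) ⟩
          ∣ ∁ B′ ∣ + ∣ B′ ∣                    ≡⟨ +-comm (∣ ∁ B′ ∣) (∣ B′ ∣) ⟩
          ∣ B′ ∣ + ∣ ∁ B′ ∣                    ≡⟨ ∣p∣+∣∁p∣≡n B′ ⟩
          n                                   ≡⟨ ∣I∣+m≡n ⟨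
          ∣ I ∣ + m                            ≤⟨ +-monoˡ-≤ m (∣partialTransversal∣≤r {𝒜 = 𝒜} I-partialTransversal) ⟩
          r + m                                ≡⟨ cong (_+ m) (∣p∣+∣∁p∣≡n (N D)) ⟨
          ∣ N D ∣ + ∣ ∁ (N D) ∣ + m            ∎))
        where
        open ≤-Reasoning hiding (start)
        1+m≤∣B′∣ : suc m ≤ ∣ B′ ∣
        1+m≤∣B′∣ = ≤-pred (subst (2 + m ≤_) ∣B∣≡1+∣B′∣ big)
        D⊆∁B′ : D ⊆ ∁ B′
        D⊆∁B′ = x∉p⇒x∈∁p ∘ D∩B′=∅
        b∈ND : b ∈ N D
        b∈ND = Hall.neighbours⁺ (member? 𝒜) last∈D (last∈ b)
        start∈∁B′─D : ∀ j → j ∈ ∁ (N D) → start j ∈ ∁ B′ ─ D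
        start∈∁B′─D j j∈∁ND = x∈p∧x∉q⇒x∈p─q (x∉p⇒x∈∁p start∉B′) start∉D
          where
          j∉ND : j ∉ N D
          j∉ND = x∈∁p⇒x∉p j∈∁ND
          start∉D : start j ∉ D
          start∉D start∈D = j∉ND (Hall.neighbours⁺ (member? 𝒜) start∈D (start∈ j))
          start∉B′ : start j ∉ B′
          start∉B′ start∈B′ = j∉ND (Hall.neighbours⁺ (member? 𝒜) last∈D
            (last∈-overhanging b j (B′⊆B start∈B′) (antichain j b λ { refl → j∉ND b∈ND })))
        ∣∁ND∣≤ : ∣ ∁ (N D) ∣ ≤ ∣ ∁ B′ ─ D ∣
        ∣∁ND∣≤ = injectiveOn⇒∣p∣≤∣q∣ (∁ (N D)) (∁ B′ ─ D) start start∈∁B′─D (λ i j _ _ → start-injective i j)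

      ∣D∣≤∣N′D∣ : ∀ {T D} → IsPartialTransversal 𝒜 T → D ⊆ T →
        (∀ {x} → x ∈ D → x ∈ B → ∃[ d ] (d ∈ D × d ∈ B′)) → ∣ D ∣ ≤ ∣ N′ D ∣
      ∣D∣≤∣N′D∣ T-transversal D⊆T reachesB′ =
        ≤-trans (partialTransversal⇒hallCondition 𝒜 T-transversal _ D⊆T) (p⊆q⇒∣p∣≤∣q∣ (N⊆N′ _ reachesB′))

      hallCondition′ : ∀ {T} → IsPartialTransversal 𝒜 T → Hall.HallCondition (member? 𝒜′) T
      hallCondition′ T-transversal D D⊆T with any? (λ d → (d ∈? D) ×-dec (d ∈? B′)) | last b ∈? D
      ... | yes (d , d∈D , d∈B′) | _ = ∣D∣≤∣N′D∣ T-transversal D⊆T (λ _ _ → d , d∈D , d∈B′)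
      ... | no _ | no last∉D =
        ∣D∣≤∣N′D∣ T-transversal D⊆T (λ x∈D x∈B → _ , x∈D , x∈p∧x≢y⇒x∈p-y x∈B (λ { refl → last∉D x∈D }))
      ... | no D∩B′=∅ | yes last∈D = ≤-pred (begin
          suc ∣ D ∣            ≤⟨ surplus D (λ x∈D x∈B′ → D∩B′=∅ (_ , x∈D , x∈B′)) last∈D ⟩
          ∣ N D ∣              ≤⟨ ∣p∣≤1+∣p-x∣ (N D) b ⟩
          suc ∣ N D - b ∣      ≤⟨ s≤s (p⊆q⇒∣p∣≤∣q∣ (N-b⊆N′ D)) ⟩
          suc ∣ N′ D ∣         ∎)
        where open ≤-Reasoning hiding (start)

      𝒜′-presents : Presents 𝒜′ M
      𝒜′-presents T = mk⇔
        (λ T-transversal′ → Equivalence.to (presents T) (partialTransversal-mono 𝒜′⊆𝒜 T-transversal′))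
        (λ MT → Hall.hall (member? 𝒜′) b (hallCondition′ (Equivalence.from (presents T) MT)))

      impossible : ⊥
      impossible = last∉B′ (subst (last b ∈_) B≡B′ (last∈ b))
        where
        B≡B′ : B ≡ B′
        B≡B′ = trans (sym (proj₂ minimal 𝒜′ (𝒜′-presents , 𝒜′-antichain , 𝒜′-intervals) 𝒜′⊆𝒜 b))
                     (updateAt-updates b 𝒜)

    B′⊆another : ∃[ j ] (j ≢ b × B′ ⊆ 𝒜 j)
    B′⊆another with any? (λ j → ¬? (j ≟ᶠ b) ×-dec (B′ ⊆? 𝒜 j))
    ... | yes found = found
    ... | no  none  = ⊥-elim (Shrink.impossible (λ j j≢b B′⊆𝒜j → none (j , j≢b , B′⊆𝒜j)))

    returns⇒∉B′ : ∀ d → d ≤ 1 → ∀ {x} → iter σ (suc d) x ≡ f → x ∉ B′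
    returns⇒∉B′ d d≤1 {x} σᵈ⁺¹x≡f x∈B′ with c , c≤k′ , σᶜf≡x ← Equivalence.to (∈B′⇔arc x) x∈B′ =
      arc-not-closed d+c≤k (0 , z≤n , sym (begin
        iter σ (suc d + c) f          ≡⟨ iter-+ (suc d) c f ⟩
        iter σ (suc d) (iter σ c f)   ≡⟨ cong (iter σ (suc d)) σᶜf≡x ⟩
        iter σ (suc d) x              ≡⟨ σᵈ⁺¹x≡f ⟩
        f                             ∎))
      where
      open ≡-Reasoning
      d+c≤k : d + c ≤ k
      d+c≤k = ≤-trans (+-mono-≤ d≤1 c≤k′) (≤-reflexive 1+k′≡k)

    -- By maximality the member containing B′ has exactly one point outside B′; being an
    -- interval through f, it can only be σ⁻¹ f, where it must start.
    predecessor : (∀ j → ∣ 𝒜 j ∣ ≤ ∣ B ∣) → ∃[ j ] (∣ 𝒜 j ∣ ≡ ∣ B ∣ × σ (start j) ≡ f)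
    predecessor maximum with j , j≢b , B′⊆𝒜j ← B′⊆another = j , ∣𝒜j∣≡∣B∣ , σ[start]≡f
      where
      ∣𝒜j∣≡∣B∣ : ∣ 𝒜 j ∣ ≡ ∣ B ∣
      ∣𝒜j∣≡∣B∣ with w , w∈𝒜j , w∉B ← p⊈q⇒∃∈p∉q (𝒜 j) B (antichain j b j≢b) =
        ≤-antisym (maximum j)
          (subst (_≤ ∣ 𝒜 j ∣) (sym ∣B∣≡1+∣B′∣) (p⊂q⇒∣p∣<∣q∣ (B′⊆𝒜j , w , w∈𝒜j , w∉B ∘ B′⊆B)))
      σ[start]≡f : σ (start j) ≡ f
      σ[start]≡f with ∈⇒arc j (B′⊆𝒜j f∈B′)
      ... | zero , _ , start≡f = ⊥-elim (j≢b (start-injective j b start≡f))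
      ... | suc zero , _ , σstart≡f = σstart≡f
      ... | suc (suc a) , a+2≤ , σu≡f = ⊥-elim (1+n≰n (begin
          2 + ∣ B′ ∣   ≤⟨ 2+∣p∣≤∣q∣ B′⊆𝒜j u∈𝒜j (returns⇒∉B′ 0 z≤n σu≡f) v∈𝒜j (returns⇒∉B′ 1 ≤-refl σu≡f) u≢v ⟩
          ∣ 𝒜 j ∣      ≡⟨ trans ∣𝒜j∣≡∣B∣ ∣B∣≡1+∣B′∣ ⟩
          1 + ∣ B′ ∣   ∎))
        where
        open ≤-Reasoning hiding (start)
        v u : Fin n
        v = iter σ a (start j)
        u = σ v
        u∈𝒜j : u ∈ 𝒜 j
        u∈𝒜j = arc⇒∈ j (suc a , ≤-trans (n≤1+n _) a+2≤ , refl)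
        v∈𝒜j : v ∈ 𝒜 j
        v∈𝒜j = arc⇒∈ j (a , ≤-trans (n≤1+n _) (≤-trans (n≤1+n _) a+2≤) , refl)
        u≢v : u ≢ v
        u≢v u≡v = returns⇒∉B′ 0 z≤n σu≡f (subst (_∈ B′) (trans (sym σu≡f) (cong σ u≡v)) f∈B′)

  starts-cover⇒singletons : (∀ y → ∃[ j ] start j ≡ y) → ∀ j → ⁅ start j ⁆ ≡ 𝒜 j
  starts-cover⇒singletons cover = proj₂ minimal 𝒜₁ (𝒜₁-presents , 𝒜₁-antichain , 𝒜₁-intervals) 𝒜₁⊆𝒜
    where
    𝒜₁ : Fin r → Subset n
    𝒜₁ j = ⁅ start j ⁆
    𝒜₁⊆𝒜 : ∀ j → 𝒜₁ j ⊆ 𝒜 j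
    𝒜₁⊆𝒜 j = x∈p⇒⁅x⁆⊆p (start∈ j)
    𝒜₁-intervals : ∀ j → IsInterval σ (𝒜₁ j)
    𝒜₁-intervals j = start j , 0 , λ x → mk⇔
      (λ x∈ → 0 , z≤n , sym (x∈⁅y⁆⇒x≡y (start j) x∈))
      (λ { (zero , _ , refl) → x∈⁅x⁆ (start j) })
    𝒜₁-antichain : IsAntichain 𝒜₁
    𝒜₁-antichain i j i≢j ⁅i⁆⊆⁅j⁆ = i≢j (start-injective i j (x∈⁅y⁆⇒x≡y (start j) (⁅i⁆⊆⁅j⁆ (x∈⁅x⁆ (start i)))))
    everything-transversal : ∀ T → IsPartialTransversal 𝒜₁ T
    everything-transversal T = proj₁ ∘ cover , ψ-∈ , ψ-inj
      where
      ψ-∈ : ∀ x → x ∈ T → x ∈ ⁅ start (proj₁ (cover x)) ⁆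
      ψ-∈ x _ = subst (_∈ ⁅ start (proj₁ (cover x)) ⁆) (proj₂ (cover x)) (x∈⁅x⁆ _)
      ψ-inj : InjectiveOn T (proj₁ ∘ cover)
      ψ-inj x y _ _ same = trans (sym (proj₂ (cover x))) (trans (cong start same) (proj₂ (cover y)))
    𝒜₁-presents : Presents 𝒜₁ M
    𝒜₁-presents T = mk⇔
      (λ T-transversal₁ → Equivalence.to (presents T) (partialTransversal-mono 𝒜₁⊆𝒜 T-transversal₁))
      (λ _ → everything-transversal T)

  module _ {b₀ : Fin r} (maximum : ∀ j → ∣ 𝒜 j ∣ ≤ ∣ 𝒜 b₀ ∣) (big : 2 + m ≤ ∣ 𝒜 b₀ ∣) where

    StartOfMaximum : Fin n → Set
    StartOfMaximum y = ∃[ j ] (∣ 𝒜 j ∣ ≡ ∣ 𝒜 b₀ ∣ × start j ≡ y)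

    startOfMaximum-σ⁻¹ : ∀ {y} → StartOfMaximum (σ y) → StartOfMaximum y
    startOfMaximum-σ⁻¹ (b , ∣b∣≡∣b₀∣ , start≡σy)
      with j , ∣j∣≡∣b∣ , σstart≡start ← BigMember.predecessor b (subst (2 + m ≤_) (sym ∣b∣≡∣b₀∣) big)
                                          (λ i → subst (∣ 𝒜 i ∣ ≤_) (sym ∣b∣≡∣b₀∣) (maximum i))
      = j , trans ∣j∣≡∣b∣ ∣b∣≡∣b₀∣ , σ-injective _ _ (trans σstart≡start start≡σy)

    startOfMaximum-iter⁻¹ : ∀ c {y} → StartOfMaximum (iter σ c y) → StartOfMaximum y
    startOfMaximum-iter⁻¹ zero    = λ s → s
    startOfMaximum-iter⁻¹ (suc c) = startOfMaximum-iter⁻¹ c ∘ startOfMaximum-σ⁻¹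

    startOfMaximum : ∀ y → StartOfMaximum y
    startOfMaximum y with c , σᶜy≡start ← reach y (start b₀) =
      startOfMaximum-iter⁻¹ c (b₀ , refl , sym σᶜy≡start)

  ∣member∣≤1+m : ∀ i → ∣ 𝒜 i ∣ ≤ suc m
  ∣member∣≤1+m i with b₀ , maximum ← maximizer (λ j → ∣ 𝒜 j ∣) i with ∣ 𝒜 b₀ ∣ ≤? suc m
  ... | yes small = ≤-trans (maximum i) small
  ... | no  large = ⊥-elim (large (begin
      ∣ 𝒜 b₀ ∣              ≡⟨ cong ∣_∣ (starts-cover⇒singletons cover b₀) ⟨
      ∣ ⁅ start b₀ ⁆ ∣      ≡⟨ ∣⁅x⁆∣≡1 (start b₀) ⟩
      1                     ≤⟨ s≤s z≤n ⟩
      suc m                 ∎))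
    where
    open ≤-Reasoning hiding (start)
    cover : ∀ y → ∃[ j ] start j ≡ y
    cover y with j , _ , start≡y ← startOfMaximum maximum (≰⇒> large) y = j , start≡y

corollary6p5 : ∀ {n} (M : Subset n → Set) (m : ℕ) →
    IsMultiPath M → HasNullity M m →
    (σ : Fin n → Fin n) → IsCyclic σ →
    ∀ {r} (𝒜 : Fin r → Subset n) → IsMinimalIntervalPresentation σ M 𝒜 →
    ∀ i → ∣ 𝒜 i ∣ ≤ suc m
corollary6p5 M m _ ((I , I-independent , ∣I∣+m≡n) , _) σ cyclic 𝒜 minimal =
  MinimalIntervalPresentation.∣member∣≤1+m cyclic minimal I-independent ∣I∣+m≡n
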